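{- There do not exist positive rational numbers $x_1,x_2,x_3,d_1,d_2,d_3$ satisfying $$x_1^2+x_2^2+x_3^2=1,\quad x_2^2+x_3^2=d_1^2,\quad x_3^2+x_1^2=d_2^2,\quad x_1^2+x_2^2=d_3^2$$ (i.e. a rational perfect cuboid with edges $x_i$, face diagonals $d_i$ and space diagonal $L=1$) together with a rational number $c$ such that $$E_{11}=c,\qquad E_{01}=c,\qquad E_{10}=c-1,$$ where $E_{10}=x_1+x_2+x_3$, $E_{01}=d_1+d_2+d_3$ and $E_{11}=x_1d_2+d_1x_2+x_2d_3+d_2x_3+x_3d_1+d_3x_1$.
   Context: A perfect cuboid is a rectangular parallelepiped with edges $x_1,x_2,x_3$, face diagonals $d_1,d_2,d_3$ and space diagonal $L$, all integers, satisfying $x_1^2+x_2^2+x_3^2=L^2$, $x_2^2+x_3^2=d_1^2$, $x_3^2+x_1^2=d_2^2$, $x_1^2+x_2^2=d_3^2$; dividing by $L$ gives an equivalent rational perfect cuboid with $L=1$. The triple $(E_{11},E_{01},E_{10})=(c,c,c-1)$ is a one-parameter family of rational solutions of the equation $(2E_{11})^2+(E_{01}^2+1-E_{10}^2)^2=8E_{01}^2$, and the theorem says no perfect cuboid is associated with this family. -}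

module Defs where

open import Data.Rational using (ℚ; _+_; _*_)

E10 : ℚ → ℚ → ℚ → ℚ
E10 x₁ x₂ x₃ = x₁ + x₂ + x₃

E01 : ℚ → ℚ → ℚ → ℚ
E01 d₁ d₂ d₃ = d₁ + d₂ + d₃

E11 : ℚ → ℚ → ℚ → ℚ → ℚ → ℚ → ℚ
E11 x₁ x₂ x₃ d₁ d₂ d₃ =
  x₁ * d₂ + d₁ * x₂ + x₂ * d₃ + d₂ * x₃ + x₃ * d₁ + d₃ * x₁

{-# OPTIONS --safe #-}
-- For a perfect cuboid with L = 1 the identities
--   E₁₀ E₀₁ − E₁₁ = x₁d₁ + x₂d₂ + x₃d₃   and   E₁₀² − 1 = x₁(x₂ + x₃) + x₂(x₃ + x₁) + x₃(x₁ + x₂)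
-- hold, and on the family (c, c, c − 1) their left-hand sides coincide.  But each face
-- diagonal is strictly shorter than the sum of its two edges, so the first right-hand side
-- is strictly smaller than the second.
module Submission where

open import Defs
open import Data.Rational using (ℚ; _+_; _*_; _-_; _<_; _≤_; 0ℚ; 1ℚ; positive; nonNegative)
open import Data.Rational.Properties
open import Data.Rational.Solver using (module +-*-Solver)
open import Data.Product using (Σ; _×_; _,_)
open import Relation.Binary.PropositionalEquality
open import Relation.Nullary using (¬_; yes; no)
open import Data.Empty using (⊥-elim)

open +-*-Solver

square-of-sum : ∀ a b → (a + b) * (a + b) ≡ (a * a + b * b) + (a * b + a * b)
square-of-sum = solve 2 (λ a b → (a :+ b) :* (a :+ b) := (a :* a :+ b :* b) :+ (a :* b :+ a :* b)) refl

sum-of-squares<square-of-sum : ∀ {a b} → 0ℚ < a → 0ℚ < b → a * a + b * b < (a + b) * (a + b)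
sum-of-squares<square-of-sum {a} {b} 0<a 0<b =
  subst₂ _<_ (+-identityʳ (a * a + b * b)) (sym (square-of-sum a b))
    (+-monoʳ-< (a * a + b * b) (+-mono-< 0<ab 0<ab))
  where
  0<ab : 0ℚ < a * b
  0<ab = positive⁻¹ (a * b) {{pos*pos⇒pos a {{positive 0<a}} b {{positive 0<b}}}}

hypotenuse<sum-of-legs : ∀ {a b d} → 0ℚ < a → 0ℚ < b → 0ℚ ≤ d → a * a + b * b ≡ d * d → d < a + b
hypotenuse<sum-of-legs {a} {b} {d} 0<a 0<b 0≤d pythagoras with d <? a + b
... | yes d<a+b = d<a+b
... | no d≮a+b = ⊥-elim (<-irrefl refl (<-≤-trans (sum-of-squares<square-of-sum 0<a 0<b) [a+b]²≤d²))
  where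
  a+b≤d : a + b ≤ d
  a+b≤d = ≮⇒≥ d≮a+b
  [a+b]²≤d² : (a + b) * (a + b) ≤ a * a + b * b
  [a+b]²≤d² = subst ((a + b) * (a + b) ≤_) (sym pythagoras)
    (≤-trans (*-monoʳ-≤-nonNeg (a + b) {{nonNegative (<⇒≤ (+-mono-< 0<a 0<b))}} a+b≤d)
             (*-monoˡ-≤-nonNeg d {{nonNegative 0≤d}} a+b≤d))

E10*E01-E11≡Σxᵢdᵢ : ∀ x₁ x₂ x₃ d₁ d₂ d₃ →
  E10 x₁ x₂ x₃ * E01 d₁ d₂ d₃ - E11 x₁ x₂ x₃ d₁ d₂ d₃ ≡ x₁ * d₁ + x₂ * d₂ + x₃ * d₃
E10*E01-E11≡Σxᵢdᵢ = solve 6 (λ x₁ x₂ x₃ d₁ d₂ d₃ →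
  (x₁ :+ x₂ :+ x₃) :* (d₁ :+ d₂ :+ d₃)
    :- (x₁ :* d₂ :+ d₁ :* x₂ :+ x₂ :* d₃ :+ d₂ :* x₃ :+ x₃ :* d₁ :+ d₃ :* x₁)
  := x₁ :* d₁ :+ x₂ :* d₂ :+ x₃ :* d₃) refl

E10²-Σxᵢ²≡Σxᵢ[xⱼ+xₖ] : ∀ x₁ x₂ x₃ →
  E10 x₁ x₂ x₃ * E10 x₁ x₂ x₃ - (x₁ * x₁ + x₂ * x₂ + x₃ * x₃)
    ≡ x₁ * (x₂ + x₃) + x₂ * (x₃ + x₁) + x₃ * (x₁ + x₂)
E10²-Σxᵢ²≡Σxᵢ[xⱼ+xₖ] = solve 3 (λ x₁ x₂ x₃ →
  (x₁ :+ x₂ :+ x₃) :* (x₁ :+ x₂ :+ x₃) :- (x₁ :* x₁ :+ x₂ :* x₂ :+ x₃ :* x₃)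
  := x₁ :* (x₂ :+ x₃) :+ x₂ :* (x₃ :+ x₁) :+ x₃ :* (x₁ :+ x₂)) refl

[c-1]*c-c≡[c-1]²-1 : ∀ c → (c - 1ℚ) * c - c ≡ (c - 1ℚ) * (c - 1ℚ) - 1ℚ
[c-1]*c-c≡[c-1]²-1 = solve 1 (λ c → (c :- con 1ℚ) :* c :- c := (c :- con 1ℚ) :* (c :- con 1ℚ) :- con 1ℚ) refl

Σxᵢdᵢ<Σxᵢ[xⱼ+xₖ] : ∀ {x₁ x₂ x₃ d₁ d₂ d₃} →
  0ℚ < x₁ → 0ℚ < x₂ → 0ℚ < x₃ → 0ℚ ≤ d₁ → 0ℚ ≤ d₂ → 0ℚ ≤ d₃ →
  x₂ * x₂ + x₃ * x₃ ≡ d₁ * d₁ → x₃ * x₃ + x₁ * x₁ ≡ d₂ * d₂ → x₁ * x₁ + x₂ * x₂ ≡ d₃ * d₃ →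
  x₁ * d₁ + x₂ * d₂ + x₃ * d₃ < x₁ * (x₂ + x₃) + x₂ * (x₃ + x₁) + x₃ * (x₁ + x₂)
Σxᵢdᵢ<Σxᵢ[xⱼ+xₖ] {x₁} {x₂} {x₃} 0<x₁ 0<x₂ 0<x₃ 0≤d₁ 0≤d₂ 0≤d₃ face₁ face₂ face₃ =
  +-mono-< (+-mono-< (*-monoʳ-<-pos x₁ {{positive 0<x₁}} (hypotenuse<sum-of-legs 0<x₂ 0<x₃ 0≤d₁ face₁))
                     (*-monoʳ-<-pos x₂ {{positive 0<x₂}} (hypotenuse<sum-of-legs 0<x₃ 0<x₁ 0≤d₂ face₂)))
           (*-monoʳ-<-pos x₃ {{positive 0<x₃}} (hypotenuse<sum-of-legs 0<x₁ 0<x₂ 0≤d₃ face₃))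

theorem4p1 :
    ¬ (Σ ℚ λ x₁ → Σ ℚ λ x₂ → Σ ℚ λ x₃ → Σ ℚ λ d₁ → Σ ℚ λ d₂ → Σ ℚ λ d₃ → Σ ℚ λ c →
        (0ℚ < x₁) × (0ℚ < x₂) × (0ℚ < x₃) × (0ℚ < d₁) × (0ℚ < d₂) × (0ℚ < d₃)
        × (x₁ * x₁ + x₂ * x₂ + x₃ * x₃ ≡ 1ℚ)
        × (x₂ * x₂ + x₃ * x₃ ≡ d₁ * d₁)
        × (x₃ * x₃ + x₁ * x₁ ≡ d₂ * d₂)
        × (x₁ * x₁ + x₂ * x₂ ≡ d₃ * d₃)
        × (E11 x₁ x₂ x₃ d₁ d₂ d₃ ≡ c)
        × (E01 d₁ d₂ d₃ ≡ c)
        × (E10 x₁ x₂ x₃ ≡ c - 1ℚ))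
theorem4p1 (x₁ , x₂ , x₃ , d₁ , d₂ , d₃ , c , 0<x₁ , 0<x₂ , 0<x₃ , 0<d₁ , 0<d₂ , 0<d₃ ,
            space , face₁ , face₂ , face₃ , e11 , e01 , e10) =
  <-irrefl Σxᵢdᵢ≡Σxᵢ[xⱼ+xₖ]
    (Σxᵢdᵢ<Σxᵢ[xⱼ+xₖ] 0<x₁ 0<x₂ 0<x₃ (<⇒≤ 0<d₁) (<⇒≤ 0<d₂) (<⇒≤ 0<d₃) face₁ face₂ face₃)
  where
  open ≡-Reasoning
  Σxᵢdᵢ≡Σxᵢ[xⱼ+xₖ] : x₁ * d₁ + x₂ * d₂ + x₃ * d₃ ≡ x₁ * (x₂ + x₃) + x₂ * (x₃ + x₁) + x₃ * (x₁ + x₂)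
  Σxᵢdᵢ≡Σxᵢ[xⱼ+xₖ] = begin
    x₁ * d₁ + x₂ * d₂ + x₃ * d₃                            ≡⟨ sym (E10*E01-E11≡Σxᵢdᵢ x₁ x₂ x₃ d₁ d₂ d₃) ⟩
    E10 x₁ x₂ x₃ * E01 d₁ d₂ d₃ - E11 x₁ x₂ x₃ d₁ d₂ d₃    ≡⟨ cong₂ (λ u v → u * v - E11 x₁ x₂ x₃ d₁ d₂ d₃) e10 e01 ⟩
    (c - 1ℚ) * c - E11 x₁ x₂ x₃ d₁ d₂ d₃                   ≡⟨ cong ((c - 1ℚ) * c -_) e11 ⟩
    (c - 1ℚ) * c - c                                       ≡⟨ [c-1]*c-c≡[c-1]²-1 c ⟩
    (c - 1ℚ) * (c - 1ℚ) - 1ℚ                               ≡⟨ sym (cong₂ (λ u v → u * u - v) e10 space) ⟩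
    E10 x₁ x₂ x₃ * E10 x₁ x₂ x₃ - (x₁ * x₁ + x₂ * x₂ + x₃ * x₃) ≡⟨ E10²-Σxᵢ²≡Σxᵢ[xⱼ+xₖ] x₁ x₂ x₃ ⟩
    x₁ * (x₂ + x₃) + x₂ * (x₃ + x₁) + x₃ * (x₁ + x₂)       ∎
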